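{- Fix positive integers $r,s$. Let $\sigma=(x,y,z)$ and $\sigma'=(x',y',z')$ be states in $\mathbf{Rec}$ that are congruent, i.e. $x\equiv x'\pmod r$ and $y\equiv y'\pmod s$. Then $\sigma$ and $\sigma'$ lie in the same orbit of $f_{r,s}$ (i.e. $f_{r,s}^k(\sigma)=\sigma'$ or $f_{r,s}^k(\sigma')=\sigma$ for some integer $k\ge0$) if and only if $g_{r,s}(\sigma)=g_{r,s}(\sigma')$.
   Context: Fix positive integers $r,s$. In the one-dimensional generalized rotor-router model, a particle starts at $0$, at each occupied site moves left if the label there is $L$ and right if it is $R$, then flips that label; on first reaching an unoccupied site to the left (resp. right) of the occupied interval, $r$ (resp. $s$) new consecutive sites on that side become occupied, labeled $R$; this defines the map $f_{r,s}$. The recurrent states $\mathbf{Rec}$ are identified with integer triples $(x,y,z)$, $x\le0\le y$, $x\le z\le y$ (the state with occupied interval $[x,y+s-1]$, labels $R$ on $[x,z-1]$, $L$ on $[z,y-1]$, $R$ on $[y,y+s-1]$); on them $f_{r,s}(x,y,z)=(x,y+s,z-y)$ if $x+y\le z$ and $f_{r,s}(x,y,z)=(x-r,y,z-x+1)$ if $x+y>z$. Also $g_{r,s}(x,y,z)=sx^2-ry^2+(r-2)sx+rsy-2rsz$. -}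

module Defs where

open import Data.Nat using (ℕ; zero; suc)
open import Data.Integer using (ℤ; +_; _+_; _-_; _*_; -_; _≤_; _≤?_)
open import Data.Integer.Divisibility using (_∣_)
open import Data.Product using (_×_; _,_; ∃-syntax)
open import Data.Sum using (_⊎_)
open import Relation.Nullary using (yes; no)
open import Relation.Binary.PropositionalEquality using (_≡_)

State : Set
State = ℤ × ℤ × ℤ

Rec : State → Set
Rec (x , y , z) = (x ≤ + 0) × (+ 0 ≤ y) × (x ≤ z) × (z ≤ y)

f : ℤ → ℤ → State → State
f r s (x , y , z) with (x + y) ≤? z
... | yes _ = (x , y + s , z - y)
... | no  _ = (x - r , y , (z - x) + + 1)

iter : (State → State) → ℕ → State → State
iter h zero    σ = σ
iter h (suc k) σ = h (iter h k σ)

g : ℤ → ℤ → State → ℤ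
g r s (x , y , z) =
  s * x * x - r * y * y + (r - + 2) * s * x + r * s * y - + 2 * r * s * z

Congruent : ℤ → ℤ → State → State → Set
Congruent r s (x , y , _) (x' , y' , _) = (r ∣ (x - x')) × (s ∣ (y - y'))

SameOrbit : ℤ → ℤ → State → State → Set
SameOrbit r s σ σ' = ∃[ k ] (iter (f r s) k σ ≡ σ' ⊎ iter (f r s) k σ' ≡ σ)

-- g is an invariant of f_{r,s}, which gives one direction. For the converse, view x and y
-- as the two ends of the occupied interval: each step of f moves exactly one of them
-- outwards by one block, x by r or y by s. Expanding g shows that g strictly increases
-- when both ends move left by at least one block. So if σ' extends σ, with its ends a
-- blocks further left and b blocks further right, the orbit of σ never overshoots an end
-- of σ' (the overshooting state would lie strictly right of σ' at both ends, yet carry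
-- the same value of g); after a + b steps it has the ends of σ', and then g determines z.
-- Of two congruent states with equal g, one extends the other, since for the same
-- reason neither lies strictly left of the other at both ends.
module Submission where

open import Defs
open import Data.Nat using (ℕ; zero; suc; z≤n; s≤s) renaming (_≤_ to _≤ℕ_)
open import Data.Integer
  using (ℤ; +_; _+_; _-_; _*_; -_; _≤_; _<_; _≤?_; +≤+; +<+; ∣_∣; >-nonZero)
open import Data.Integer.Properties
  using (≤-reflexive; ≤-total; <⇒≤; <⇒≢; ≰⇒>; +-mono-≤; +-monoʳ-≤; +-monoʳ-<; +-mono-≤-<;
         +-identityʳ; neg-mono-≤; i≤j⇒0≤j-i; 0≤i-j⇒j≤i; i≤j⇒i-k≤j; i<j⇒suc[i]≤j;
         0≤i⇒+∣i∣≡i; pos-*; ∣i-j∣≡∣j-i∣; *-cancelˡ-≡)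
open import Data.Integer.Divisibility using (_∣_; divides)
open import Data.Nat.Divisibility using () renaming (_∣_ to _∣ℕ_)
open import Data.Integer.Solver using (module +-*-Solver)
open import Data.Integer.Tactic.RingSolver using (solve-∀)
open import Data.Product using (_×_; _,_; ∃-syntax; map₂)
open import Data.Sum using (_⊎_; inj₁; inj₂; [_,_]′)
open import Data.Empty using (⊥-elim)
open import Relation.Nullary using (¬_; yes; no)
open import Relation.Binary.PropositionalEquality
  using (_≡_; refl; sym; trans; cong; subst; subst₂; module ≡-Reasoning)

open +-*-Solver using (Polynomial; con; _:+_; _:-_; _:*_; :-_; _:=_; solve)

-- g transcribed into the syntax of the ring solver. Its evaluation is g definitionally,
-- so the solver proves identities about g, which the reflective solve-∀ cannot unfold.
gₚ : ∀ {n} → (r s x y z : Polynomial n) → Polynomial n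
gₚ r s x y z =
  s :* x :* x :- r :* y :* y :+ (r :- con (+ 2)) :* s :* x :+ r :* s :* y
  :- con (+ 2) :* r :* s :* z

g-right-step : ∀ r s x y z → g r s (x , y + s , z - y) ≡ g r s (x , y , z)
g-right-step = solve 5 (λ r s x y z → gₚ r s x (y :+ s) (z :- y) := gₚ r s x y z) refl

g-left-step : ∀ r s x y z → g r s (x - r , y , (z - x) + + 1) ≡ g r s (x , y , z)
g-left-step =
  solve 5 (λ r s x y z → gₚ r s (x :- r) y ((z :- x) :+ con (+ 1)) := gₚ r s x y z) refl

g-linear-in-z : ∀ r s x y z → + 2 * r * s * z ≡ g r s (x , y , + 0) - g r s (x , y , z)
g-linear-in-z = solve 5 (λ r s x y z →
  con (+ 2) :* r :* s :* z := gₚ r s x y (con (+ 0)) :- gₚ r s x y z) refl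

-- If both states are recurrent, x' + r ≤ x and y' + s ≤ y, then every summand of the
-- increment is nonnegative and the last one is positive.
g-left-shift : ∀ r s x y z x' y' z' →
  g r s (x' , y' , z') ≡
    g r s (x , y , z)
    + (s * (x - (x' + r)) * - (x + x') + r * (y - (y' + s)) * (y + y')
       + + 2 * r * s * (z - x) + + 2 * r * s * (y' - z') + + 2 * s * (x - (x' + r))
       + + 2 * r * s)
g-left-shift = solve 8 (λ r s x y z x' y' z' →
  gₚ r s x' y' z' :=
    gₚ r s x y z
    :+ (s :* (x :- (x' :+ r)) :* :- (x :+ x') :+ r :* (y :- (y' :+ s)) :* (y :+ y')
        :+ con (+ 2) :* r :* s :* (z :- x) :+ con (+ 2) :* r :* s :* (y' :- z')
        :+ con (+ 2) :* s :* (x :- (x' :+ r))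
        :+ con (+ 2) :* r :* s)) refl

g-invariant : ∀ r s σ → g r s (f r s σ) ≡ g r s σ
g-invariant r s (x , y , z) with (x + y) ≤? z
... | yes _ = g-right-step r s x y z
... | no  _ = g-left-step r s x y z

g-iter-invariant : ∀ r s k σ → g r s (iter (f r s) k σ) ≡ g r s σ
g-iter-invariant r s zero    σ = refl
g-iter-invariant r s (suc k) σ = trans (g-invariant r s (iter (f r s) k σ)) (g-iter-invariant r s k σ)

sameOrbit⇒g≡ : ∀ r s σ σ' → SameOrbit r s σ σ' → g r s σ ≡ g r s σ'
sameOrbit⇒g≡ r s σ σ' (k , inj₁ eq) = trans (sym (g-iter-invariant r s k σ)) (cong (g r s) eq)
sameOrbit⇒g≡ r s σ σ' (k , inj₂ eq) = trans (sym (cong (g r s) eq)) (g-iter-invariant r s k σ')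

f-cases : ∀ r s x y z →
  (x + y ≤ z × f r s (x , y , z) ≡ (x , y + s , z - y)) ⊎
  (z < x + y × f r s (x , y , z) ≡ (x - r , y , (z - x) + + 1))
f-cases r s x y z with (x + y) ≤? z
... | yes x+y≤z = inj₁ (x+y≤z , refl)
... | no  x+y≰z = inj₂ (≰⇒> x+y≰z , refl)

iter-suc′ : ∀ (h : State → State) k σ → iter h (suc k) σ ≡ iter h k (h σ)
iter-suc′ h zero    σ = refl
iter-suc′ h (suc k) σ = cong h (iter-suc′ h k σ)

0≤i⇒0≤j⇒0≤i*j : ∀ {i j} → + 0 ≤ i → + 0 ≤ j → + 0 ≤ i * j
0≤i⇒0≤j⇒0≤i*j (+≤+ {n = m} _) (+≤+ {n = n} _) = subst (+ 0 ≤_) (pos-* m n) (+≤+ z≤n)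

0<i⇒0<j⇒0<i*j : ∀ {i j} → + 0 < i → + 0 < j → + 0 < i * j
0<i⇒0<j⇒0<i*j (+<+ (s≤s z≤n)) (+<+ (s≤s z≤n)) = +<+ (s≤s z≤n)

infixl 6 _⊕_
_⊕_ : ∀ {i j} → + 0 ≤ i → + 0 ≤ j → + 0 ≤ i + j
_⊕_ = +-mono-≤

≤-by-difference : ∀ {i j} e → j - i ≡ e → + 0 ≤ e → i ≤ j
≤-by-difference e j-i≡e 0≤e = 0≤i-j⇒j≤i (subst (+ 0 ≤_) (sym j-i≡e) 0≤e)

∣-flip : ∀ k i j → k ∣ i - j → k ∣ j - i
∣-flip k i j = subst (∣ k ∣ ∣ℕ_) (∣i-j∣≡∣j-i∣ i j)

Congruent-sym : ∀ m n σ σ' → Congruent m n σ σ' → Congruent m n σ' σ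
Congruent-sym m n (x , y , z) (x' , y' , z') (m∣ , n∣) = ∣-flip m x x' m∣ , ∣-flip n y y' n∣

∣⇒offset : ∀ m {u v} → v ≤ u → + m ∣ u - v → ∃[ q ] u ≡ v + + q * + m
∣⇒offset m {u} {v} v≤u (divides q ∣u-v∣≡q*m) = q , (begin
  u                 ≡⟨ u≡v+[u-v] u v ⟩
  v + (u - v)       ≡⟨ cong (λ i → v + i) (0≤i⇒+∣i∣≡i (i≤j⇒0≤j-i v≤u)) ⟨
  v + + ∣ u - v ∣   ≡⟨ cong (λ n → v + + n) ∣u-v∣≡q*m ⟩
  v + + _           ≡⟨ cong (λ i → v + i) (pos-* q m) ⟩
  v + + q * + m     ∎)
  where
    open ≡-Reasoning
    u≡v+[u-v] : ∀ u v → u ≡ v + (u - v)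
    u≡v+[u-v] = solve-∀

offset-zero : ∀ v {u} → u ≡ v + + 0 → u ≡ v
offset-zero v eq = trans eq (+-identityʳ v)

offset-pred : ∀ v m q {u} → u ≡ v + + suc q * m → u - m ≡ v + + q * m
offset-pred v m q eq = trans (cong (_- m) eq) (drop-one v (+ q) m)
  where
    drop-one : ∀ v q m → (v + (+ 1 + q) * m) - m ≡ v + q * m
    drop-one = solve-∀

offset-shift : ∀ v m q {u} → u ≡ v + + suc q * m → u ≡ (v + m) + + q * m
offset-shift v m q eq = trans eq (move-one v (+ q) m)
  where
    move-one : ∀ v q m → v + (+ 1 + q) * m ≡ (v + m) + q * m
    move-one = solve-∀

offset-suc⇒≤ : ∀ v m q {u} → + 0 ≤ m → u ≡ v + + suc q * m → v + m ≤ u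
offset-suc⇒≤ v m q 0≤m eq = subst₂ _≤_ (+-identityʳ (v + m)) (sym (offset-shift v m q eq))
  (+-monoʳ-≤ (v + m) (0≤i⇒0≤j⇒0≤i*j (+≤+ {n = q} z≤n) 0≤m))

Rec-right-step : ∀ s {x y z} → Rec (x , y , z) → x + y ≤ z → Rec (x , y + + s , z - y)
Rec-right-step s {x} {y} {z} (x≤0 , 0≤y , _ , z≤y) x+y≤z =
  x≤0 ,
  0≤y ⊕ +≤+ z≤n ,
  ≤-by-difference _ (left-gap x y z) (i≤j⇒0≤j-i x+y≤z) ,
  ≤-by-difference _ (right-gap y z (+ s))
    (i≤j⇒0≤j-i z≤y ⊕ 0≤y ⊕ +≤+ z≤n)
  where
    left-gap : ∀ x y z → (z - y) - x ≡ z - (x + y)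
    left-gap = solve-∀
    right-gap : ∀ y z s → (y + s) - (z - y) ≡ (y - z) + y + s
    right-gap = solve-∀

Rec-left-step : ∀ r {x y z} → Rec (x , y , z) → z < x + y → Rec (x - + r , y , (z - x) + + 1)
Rec-left-step r {x} {y} {z} (x≤0 , 0≤y , x≤z , _) z<x+y =
  i≤j⇒i-k≤j (+ r) x≤0 ,
  0≤y ,
  ≤-by-difference _ (left-gap x z (+ r))
    (i≤j⇒0≤j-i x≤z ⊕ neg-mono-≤ x≤0 ⊕ +≤+ z≤n ⊕ +≤+ z≤n) ,
  ≤-by-difference _ (right-gap x y z) (i≤j⇒0≤j-i (i<j⇒suc[i]≤j z<x+y))
  where
    left-gap : ∀ x z r → ((z - x) + + 1) - (x - r) ≡ (z - x) + - x + r + + 1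
    left-gap = solve-∀
    right-gap : ∀ x y z → y - ((z - x) + + 1) ≡ (x + y) - (+ 1 + z)
    right-gap = solve-∀

module Orbits (r s : ℕ) (1≤r : 1 ≤ℕ r) (1≤s : 1 ≤ℕ s) where

  F : State → State
  F = f (+ r) (+ s)

  G : State → ℤ
  G = g (+ r) (+ s)

  0≤r : + 0 ≤ + r
  0≤r = +≤+ z≤n

  0≤s : + 0 ≤ + s
  0≤s = +≤+ z≤n

  0<2rs : + 0 < + 2 * + r * + s
  0<2rs = 0<i⇒0<j⇒0<i*j (0<i⇒0<j⇒0<i*j (+<+ {n = 2} (s≤s z≤n)) (+<+ 1≤r)) (+<+ 1≤s)

  G-injective-in-z : ∀ {x y z z'} → G (x , y , z) ≡ G (x , y , z') → z ≡ z'
  G-injective-in-z {x} {y} {z} {z'} eq =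
    *-cancelˡ-≡ (+ 2 * + r * + s) z z' ⦃ >-nonZero 0<2rs ⦄ (begin
      + 2 * + r * + s * z                ≡⟨ g-linear-in-z (+ r) (+ s) x y z ⟩
      G (x , y , + 0) - G (x , y , z)    ≡⟨ cong (λ i → G (x , y , + 0) - i) eq ⟩
      G (x , y , + 0) - G (x , y , z')   ≡⟨ g-linear-in-z (+ r) (+ s) x y z' ⟨
      + 2 * + r * + s * z'               ∎)
    where open ≡-Reasoning

  G-<-left-shift : ∀ {x y z x' y' z'} → Rec (x , y , z) → Rec (x' , y' , z') →
    x' + + r ≤ x → y' + + s ≤ y → G (x , y , z) < G (x' , y' , z')
  G-<-left-shift {x} {y} {z} {x'} {y'} {z'} (x≤0 , 0≤y , x≤z , _) (x'≤0 , 0≤y' , _ , z'≤y')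
    x'+r≤x y'+s≤y =
    subst₂ _<_ (+-identityʳ (G (x , y , z))) (sym (g-left-shift (+ r) (+ s) x y z x' y' z'))
      (+-monoʳ-< (G (x , y , z)) (+-mono-≤-<
        (0≤i⇒0≤j⇒0≤i*j (0≤i⇒0≤j⇒0≤i*j 0≤s 0≤D) (neg-mono-≤ (+-mono-≤ x≤0 x'≤0))
        ⊕ 0≤i⇒0≤j⇒0≤i*j (0≤i⇒0≤j⇒0≤i*j 0≤r (i≤j⇒0≤j-i y'+s≤y)) (0≤y ⊕ 0≤y')
        ⊕ 0≤i⇒0≤j⇒0≤i*j 0≤2rs (i≤j⇒0≤j-i x≤z)
        ⊕ 0≤i⇒0≤j⇒0≤i*j 0≤2rs (i≤j⇒0≤j-i z'≤y')
        ⊕ 0≤i⇒0≤j⇒0≤i*j (0≤i⇒0≤j⇒0≤i*j (+≤+ {n = 2} z≤n) 0≤s) 0≤D)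
        0<2rs))
    where
      0≤2rs : + 0 ≤ + 2 * + r * + s
      0≤2rs = <⇒≤ 0<2rs
      0≤D : + 0 ≤ x - (x' + + r)
      0≤D = i≤j⇒0≤j-i x'+r≤x

  Reaches : State → State → Set
  Reaches σ σ' = ∃[ k ] iter F k σ ≡ σ'

  Reaches-step : ∀ {σ τ σ'} → F σ ≡ τ → Reaches τ σ' → Reaches σ σ'
  Reaches-step {σ} Fσ≡τ (k , eq) =
    suc k , trans (iter-suc′ F k σ) (trans (cong (iter F k) Fσ≡τ) eq)

  Extends : ℕ → ℕ → State → State → Set
  Extends a b (x , y , _) (x' , y' , _) = (x ≡ x' + + a * + r) × (y' ≡ y + + b * + s)

  ¬right-step-at-right-end : ∀ a {x y z x' y' z'} → Rec (x , y , z) → Rec (x' , y' , z') →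
    Extends (suc a) 0 (x , y , z) (x' , y' , z') → G (x , y , z) ≡ G (x' , y' , z') →
    ¬ (x + y ≤ z)
  ¬right-step-at-right-end a {x} {y} {z} {x'} rc rc' (ex , ey) eq x+y≤z =
    <⇒≢ (G-<-left-shift (Rec-right-step s rc x+y≤z) rc'
          (offset-suc⇒≤ x' (+ r) a 0≤r ex) (≤-reflexive (cong (_+ + s) (offset-zero y ey))))
        (trans (g-right-step (+ r) (+ s) x y z) eq)

  ¬left-step-at-left-end : ∀ b {x y z x' y' z'} → Rec (x , y , z) → Rec (x' , y' , z') →
    Extends 0 (suc b) (x , y , z) (x' , y' , z') → G (x , y , z) ≡ G (x' , y' , z') →
    ¬ (z < x + y)
  ¬left-step-at-left-end b {x} {y} {z} {x'} rc rc' (ex , ey) eq z<x+y =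
    <⇒≢ (G-<-left-shift rc' (Rec-left-step r rc z<x+y)
          (≤-reflexive (trans (x-r+r≡x x (+ r)) (offset-zero x' ex)))
          (offset-suc⇒≤ y (+ s) b 0≤s ey))
        (trans (sym eq) (sym (g-left-step (+ r) (+ s) x y z)))
    where
      x-r+r≡x : ∀ x r → x - r + r ≡ x
      x-r+r≡x = solve-∀

  extends⇒reaches : ∀ a b {x y z x' y' z'} → Rec (x , y , z) → Rec (x' , y' , z') →
    Extends a b (x , y , z) (x' , y' , z') → G (x , y , z) ≡ G (x' , y' , z') →
    Reaches (x , y , z) (x' , y' , z')
  extends⇒reaches a b {x} {y} {z} rc rc' ext eq with f-cases (+ r) (+ s) x y z
  extends⇒reaches zero zero {y = y} {x' = x'} rc rc' (ex , ey) eq | _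
    with offset-zero x' ex | offset-zero y ey
  ... | refl | refl = 0 , cong (λ z → _ , _ , z) (G-injective-in-z eq)
  extends⇒reaches a (suc b) {x} {y} {z} {x'} rc rc' (ex , ey) eq | inj₁ (x+y≤z , step) =
    Reaches-step step (extends⇒reaches a b (Rec-right-step s rc x+y≤z) rc'
      (ex , offset-shift y (+ s) b ey) (trans (g-right-step (+ r) (+ s) x y z) eq))
  extends⇒reaches (suc a) zero rc rc' ext eq | inj₁ (x+y≤z , _) =
    ⊥-elim (¬right-step-at-right-end a rc rc' ext eq x+y≤z)
  extends⇒reaches (suc a) b {x} {y} {z} {x'} rc rc' (ex , ey) eq | inj₂ (z<x+y , step) =
    Reaches-step step (extends⇒reaches a b (Rec-left-step r rc z<x+y) rc'
      (offset-pred x' (+ r) a ex , ey) (trans (g-left-step (+ r) (+ s) x y z) eq))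
  extends⇒reaches zero (suc b) rc rc' ext eq | inj₂ (z<x+y , _) =
    ⊥-elim (¬left-step-at-left-end b rc rc' ext eq z<x+y)

  ≤⇒reaches : ∀ {x y z x' y' z'} → Rec (x , y , z) → Rec (x' , y' , z') →
    Congruent (+ r) (+ s) (x , y , z) (x' , y' , z') → x' ≤ x → y ≤ y' →
    G (x , y , z) ≡ G (x' , y' , z') → Reaches (x , y , z) (x' , y' , z')
  ≤⇒reaches {x} {y} {_} {x'} {y'} rc rc' (r∣x-x' , s∣y-y') x'≤x y≤y' eq
    with ∣⇒offset r x'≤x r∣x-x' | ∣⇒offset s y≤y' (∣-flip (+ s) y y' s∣y-y')
  ... | a , ex | b , ey = extends⇒reaches a b rc rc' (ex , ey) eq

  left-shift⇒common-end : ∀ {x y z x' y' z'} → Rec (x , y , z) → Rec (x' , y' , z') →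
    Congruent (+ r) (+ s) (x , y , z) (x' , y' , z') → x' ≤ x → y' ≤ y →
    G (x , y , z) ≡ G (x' , y' , z') → x ≡ x' ⊎ y ≡ y'
  left-shift⇒common-end {x} {y} {_} {x'} {y'} rc rc' (r∣x-x' , s∣y-y') x'≤x y'≤y eq
    with ∣⇒offset r x'≤x r∣x-x' | ∣⇒offset s y'≤y s∣y-y'
  ... | zero  , ex | _          = inj₁ (offset-zero x' ex)
  ... | suc _ , _  | zero  , ey = inj₂ (offset-zero y' ey)
  ... | suc a , ex | suc b , ey =
    ⊥-elim (<⇒≢ (G-<-left-shift rc rc' (offset-suc⇒≤ x' (+ r) a 0≤r ex)
                                        (offset-suc⇒≤ y' (+ s) b 0≤s ey)) eq)

  g≡⇒sameOrbit : ∀ σ σ' → Rec σ → Rec σ' → Congruent (+ r) (+ s) σ σ' → G σ ≡ G σ' →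
    SameOrbit (+ r) (+ s) σ σ'
  g≡⇒sameOrbit σ@(x , y , _) σ'@(x' , y' , _) rc rc' c eq = cases (≤-total x' x) (≤-total y y')
    where
      c' : Congruent (+ r) (+ s) σ' σ
      c' = Congruent-sym (+ r) (+ s) σ σ' c

      forwards : x' ≤ x → y ≤ y' → SameOrbit (+ r) (+ s) σ σ'
      forwards x'≤x y≤y' = map₂ inj₁ (≤⇒reaches rc rc' c x'≤x y≤y' eq)

      backwards : x ≤ x' → y' ≤ y → SameOrbit (+ r) (+ s) σ σ'
      backwards x≤x' y'≤y = map₂ inj₂ (≤⇒reaches rc' rc c' x≤x' y'≤y (sym eq))

      cases : x' ≤ x ⊎ x ≤ x' → y ≤ y' ⊎ y' ≤ y → SameOrbit (+ r) (+ s) σ σ'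
      cases (inj₁ x'≤x) (inj₁ y≤y') = forwards x'≤x y≤y'
      cases (inj₂ x≤x') (inj₂ y'≤y) = backwards x≤x' y'≤y
      cases (inj₁ x'≤x) (inj₂ y'≤y) =
        [ (λ x≡x' → backwards (≤-reflexive x≡x') y'≤y)
        , (λ y≡y' → forwards x'≤x (≤-reflexive y≡y')) ]′
        (left-shift⇒common-end rc rc' c x'≤x y'≤y eq)
      cases (inj₂ x≤x') (inj₁ y≤y') =
        [ (λ x'≡x → forwards (≤-reflexive x'≡x) y≤y')
        , (λ y'≡y → backwards x≤x' (≤-reflexive y'≡y)) ]′
        (left-shift⇒common-end rc' rc c' x≤x' y≤y' (sym eq))

theorem2p9 : (r s : ℕ) → 1 ≤ℕ r → 1 ≤ℕ s → (σ σ' : State) →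
    Rec σ → Rec σ' → Congruent (+ r) (+ s) σ σ' →
    ((SameOrbit (+ r) (+ s) σ σ' → g (+ r) (+ s) σ ≡ g (+ r) (+ s) σ')
     × (g (+ r) (+ s) σ ≡ g (+ r) (+ s) σ' → SameOrbit (+ r) (+ s) σ σ'))
theorem2p9 r s 1≤r 1≤s σ σ' rc rc' c =
  sameOrbit⇒g≡ (+ r) (+ s) σ σ' , Orbits.g≡⇒sameOrbit r s 1≤r 1≤s σ σ' rc rc' c
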